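{- Let $F,G$ be set functors with sets of evaluation maps $\Lambda^F$, $\Lambda^G$ and $\zeta\colon F\Rightarrow G$ a natural transformation. If $\{\mathit{ev}_G\circ\zeta_\mathcal{V}\mid\mathit{ev}_G\in\Lambda^G\}\subseteq\Lambda^F$, then every component $\zeta_X$ is non-expansive from $(FX,\overline F(d))$ to $(GX,\overline G(d))$ for every $(X,d)$, so $\zeta$ lifts to a natural transformation $\overline F\Rightarrow\overline G$ on $\mathcal{V}\text{ - }\mathsf{Graph}$.
   Context: $\mathcal{V}$ is a quantale with order $\sqsubseteq$, meets $\bigwedge$, residuation $d_\mathcal{V}$. $\mathcal{V}\text{ - }\mathsf{Graph}$: objects $(X,d)$, $d\colon X\times X\to\mathcal{V}$, morphisms $f$ with $d_X\sqsubseteq d_Y\circ(f\times f)$. Kantorovich lifting: $\overline F(d)(s,t)=\bigwedge_{\mathit{ev}\in\Lambda^F}\bigwedge_{f\in\gamma_X(d)}d_\mathcal{V}(\mathit{ev}(Ff(s)),\mathit{ev}(Ff(t)))$, $\gamma_X(d)=\{f\colon X\to\mathcal{V}\mid d\sqsubseteq d_\mathcal{V}\circ(f\times f)\}$, similarly for $G$. -}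

module Defs where

open import Level using (0ℓ)
open import Data.Product using (Σ; _×_; _,_; proj₁; proj₂)
open import Function using (_∘_; id)
open import Relation.Binary.PropositionalEquality using (_≡_)
open import Relation.Binary.Structures using (IsPartialOrder)

record Quantale : Set₁ where
  infixr 7 _⊗_
  infix 4 _⊑_
  field
    Carrier        : Set
    _⊑_            : Carrier → Carrier → Set
    isPartialOrder : IsPartialOrder _≡_ _⊑_
    ⋀              : {I : Set} → (I → Carrier) → Carrier
    ⋀-lb           : {I : Set} (f : I → Carrier) (i : I) → ⋀ f ⊑ f i
    ⋀-glb          : {I : Set} (f : I → Carrier) (x : Carrier) →
                     ((i : I) → x ⊑ f i) → x ⊑ ⋀ f
    ⋁              : {I : Set} → (I → Carrier) → Carrier
    ⋁-ub           : {I : Set} (f : I → Carrier) (i : I) → f i ⊑ ⋁ f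
    ⋁-lub          : {I : Set} (f : I → Carrier) (x : Carrier) →
                     ((i : I) → f i ⊑ x) → ⋁ f ⊑ x
    _⊗_            : Carrier → Carrier → Carrier
    k              : Carrier
    ⊗-assoc        : (a b c : Carrier) → (a ⊗ b) ⊗ c ≡ a ⊗ (b ⊗ c)
    ⊗-identityˡ    : (a : Carrier) → k ⊗ a ≡ a
    ⊗-identityʳ    : (a : Carrier) → a ⊗ k ≡ a
    ⊗-distribˡ-⋁   : {I : Set} (a : Carrier) (f : I → Carrier) →
                     a ⊗ ⋁ f ≡ ⋁ (λ i → a ⊗ f i)
    ⊗-distribʳ-⋁   : {I : Set} (a : Carrier) (f : I → Carrier) →
                     ⋁ f ⊗ a ≡ ⋁ (λ i → f i ⊗ a)
    d              : Carrier → Carrier → Carrier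
    residuate      : (a b c : Carrier) → a ⊗ c ⊑ b → c ⊑ d a b
    residuate⁻¹    : (a b c : Carrier) → c ⊑ d a b → a ⊗ c ⊑ b

record SetFunctor : Set₁ where
  field
    F₀      : Set → Set
    fmap    : {X Y : Set} → (X → Y) → F₀ X → F₀ Y
    fmap-id : {X : Set} (x : F₀ X) → fmap (id {A = X}) x ≡ x
    fmap-∘  : {X Y Z : Set} (g : Y → Z) (f : X → Y) (x : F₀ X) →
              fmap (g ∘ f) x ≡ fmap g (fmap f x)
open SetFunctor public

record NatTrans (F G : SetFunctor) : Set₁ where
  field
    η          : (X : Set) → F₀ F X → F₀ G X
    naturality : {X Y : Set} (f : X → Y) (x : F₀ F X) →
                 η Y (fmap F f x) ≡ fmap G f (η X x)
open NatTrans public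

module _ (V : Quantale) where
  open Quantale V

  VRel : Set → Set
  VRel X = X → X → Carrier

  NonExpansive : {X Y : Set} → VRel X → VRel Y → (X → Y) → Set
  NonExpansive dX dY f = ∀ x x' → dX x x' ⊑ dY (f x) (f x')

  γ : {X : Set} → VRel X → (X → Carrier) → Set
  γ dX f = NonExpansive dX d f

  EvalMaps : SetFunctor → Set₁
  EvalMaps F = (F₀ F Carrier → Carrier) → Set

  Kantorovich : (F : SetFunctor) → EvalMaps F →
                {X : Set} → VRel X → VRel (F₀ F X)
  Kantorovich F Λ {X} dX s t =
    ⋀ {I = Σ (F₀ F Carrier → Carrier) Λ}
      (λ ev → ⋀ {I = Σ (X → Carrier) (γ dX)}
        (λ f → d (proj₁ ev (fmap F (proj₁ f) s))
                 (proj₁ ev (fmap F (proj₁ f) t))))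

{-# OPTIONS --safe #-}
module Submission where

open import Defs
open import Function using (_∘_)
open import Data.Product using (_,_)
open import Relation.Binary.PropositionalEquality using (subst₂)
open import Relation.Binary.Structures using (IsPartialOrder)

-- Every term of the meet defining the lifted distance of ζ s and ζ t is, by
-- naturality of ζ, a term of the meet defining the lifted distance of s and t:
-- the one for the evaluation map ev ∘ ζ_V, which lies in Λ^F by hypothesis.

module _ (V : Quantale) where
  open Quantale V
  open IsPartialOrder isPartialOrder using (trans)

  Kantorovich-lb : (F : SetFunctor) (Λ : EvalMaps V F) {X : Set} (dX : VRel V X)
                   {ev : F₀ F Carrier → Carrier} → Λ ev →
                   {f : X → Carrier} → γ V dX f → (s t : F₀ F X) →
                   Kantorovich V F Λ dX s t ⊑ d (ev (fmap F f s)) (ev (fmap F f t))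
  Kantorovich-lb F Λ dX ev∈Λ f∈γ s t =
    trans (⋀-lb _ (_ , ev∈Λ)) (⋀-lb _ (_ , f∈γ))

  Kantorovich-glb : (F : SetFunctor) (Λ : EvalMaps V F) {X : Set} (dX : VRel V X)
                    {s t : F₀ F X} (x : Carrier) →
                    ((ev : F₀ F Carrier → Carrier) → Λ ev →
                     (f : X → Carrier) → γ V dX f →
                     x ⊑ d (ev (fmap F f s)) (ev (fmap F f t))) →
                    x ⊑ Kantorovich V F Λ dX s t
  Kantorovich-glb F Λ dX x below =
    ⋀-glb _ x λ { (ev , ev∈Λ) → ⋀-glb _ x λ { (f , f∈γ) → below ev ev∈Λ f f∈γ } }

mainTheorem11 : (V : Quantale) (F G : SetFunctor)
    (ΛF : EvalMaps V F) (ΛG : EvalMaps V G) (ζ : NatTrans F G) →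
    ((ev : F₀ G (Quantale.Carrier V) → Quantale.Carrier V) →
      ΛG ev → ΛF (ev ∘ η ζ (Quantale.Carrier V))) →
    (X : Set) (dX : VRel V X) →
    NonExpansive V (Kantorovich V F ΛF dX) (Kantorovich V G ΛG dX) (η ζ X)
mainTheorem11 V F G ΛF ΛG ζ ΛG∘ζ⊆ΛF X dX s t =
  Kantorovich-glb V G ΛG dX _ λ ev ev∈ΛG f f∈γ →
    subst₂ (λ a b → Kantorovich V F ΛF dX s t ⊑ d (ev a) (ev b))
      (naturality ζ f s) (naturality ζ f t)
      (Kantorovich-lb V F ΛF dX (ΛG∘ζ⊆ΛF ev ev∈ΛG) f∈γ s t)
  where open Quantale V using (_⊑_; d)
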